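{- Let $k$ be a nonnegative integer and $n=2k+1$. Then $rn(C_n\square C_n)\ge \frac{n^2-1}{2}(k+1)+1$.
   Context: $C_n$ is the cycle graph with vertex set $\{0,\dots,n-1\}$, distinct $v,w$ adjacent iff $v\equiv w\pm1 \pmod n$. The Cartesian product $G\square H$ has vertex set $V(G)\times V(H)$, with $(g,h)\sim(g',h')$ iff ($g=g'$ and $hh'\in E(H)$) or ($h=h'$ and $gg'\in E(G)$). $d(u,v)$ is graph distance and $\operatorname{diam}(G)$ the maximum distance in $G$. A radio labeling of a connected graph $G$ is a function $c:V(G)\to\{1,2,\dots\}$ with $d(u,v)+|c(u)-c(v)|\ge 1+\operatorname{diam}(G)$ for all distinct $u,v$. The span of $c$ is its maximum value; $rn(G)$ is the minimum span over all radio labelings of $G$. -}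

module Defs where

open import Data.Nat using (ℕ; zero; suc; _+_; _*_; _∸_; _≤_; _<_; NonZero)
open import Data.Nat.Base using (∣_-_∣)
open import Data.Fin using (Fin; toℕ)
open import Data.Product using (_×_; _,_; Σ; ∃)
open import Relation.Binary.PropositionalEquality using (_≡_; _≢_)
open import Relation.Nullary using (¬_)
open import Data.Sum using (_⊎_)

record Graph : Set₁ where
  field
    V   : Set
    Adj : V → V → Set
open Graph public

open import Data.Nat.DivMod using (_%_)

cycle : (n : ℕ) → .{{NonZero n}} → Graph
cycle n = record
  { V   = Fin n
  ; Adj = λ v w → (v ≢ w) × ((toℕ w ≡ (toℕ v + 1) % n) ⊎ (toℕ v ≡ (toℕ w + 1) % n))
  }

_□_ : Graph → Graph → Graph
G □ H = record
  { V   = V G × V H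
  ; Adj = λ { (g , h) (g' , h') → ((g ≡ g') × Adj H h h') ⊎ ((h ≡ h') × Adj G g g') }
  }

data Walk (G : Graph) : V G → V G → ℕ → Set where
  here : ∀ {u} → Walk G u u zero
  step : ∀ {u w v m} → Adj G u w → Walk G w v m → Walk G u v (suc m)

IsDist : (G : Graph) → V G → V G → ℕ → Set
IsDist G u v m = Walk G u v m × (∀ l → l < m → ¬ Walk G u v l)

IsDiam : (G : Graph) → ℕ → Set
IsDiam G D = (Σ (V G) λ u → Σ (V G) λ v → IsDist G u v D)
           × (∀ u v m → IsDist G u v m → m ≤ D)

IsRadioLabeling : (G : Graph) → (V G → ℕ) → Set
IsRadioLabeling G c =
  (∀ u → 1 ≤ c u) ×
  (∀ u v → u ≢ v → ∀ m D → IsDist G u v m → IsDiam G D → suc D ≤ m + ∣ c u - c v ∣)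

-- span(c) ≥ B  (span = max value of c): some vertex gets label ≥ B.
SpanAtLeast : (G : Graph) → (V G → ℕ) → ℕ → Set
SpanAtLeast G c B = Σ (V G) λ u → B ≤ c u

RnAtLeast : Graph → ℕ → Set
RnAtLeast G B = ∀ (c : V G → ℕ) → IsRadioLabeling G c → SpanAtLeast G c B

-- In C_n □ C_n with n = 2k + 1 the diameter is 2k, and any three vertices x, y, z lie on a closed
-- walk x → y → z → x of length at most 2n (in each coordinate, three points cut the cycle into three
-- arcs of total length n).  Adding the three radio conditions for labels c x ≤ c y ≤ c z gives
-- 3(2k + 1) ≤ 2n + 2(c z − c x), so c z − c x ≥ k + 1: no three vertices carry labels from one block
-- of k + 1 consecutive integers.  With span at most M(k + 1), where M = (n² − 1)/2, the labels fall
-- into M such blocks, and as n² > 2M some block would receive three vertices.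

module Submission where

open import Defs
open import Data.Empty using (⊥; ⊥-elim)
open import Data.Fin using (Fin; zero; suc; toℕ; fromℕ; fromℕ<; punchIn; punchOut)
open import Data.Fin.Properties
  using (any?; toℕ<n; toℕ-injective; toℕ-fromℕ; toℕ-fromℕ<; *↔×; pigeonhole;
         punchIn-injective; punchInᵢ≢i; punchIn-punchOut; punchOut-injective)
  renaming (_≟_ to _≟ᶠ_; <⇒≢ to <⇒≢ᶠ)
open import Data.Nat
  using (ℕ; zero; suc; pred; _+_; _*_; _∸_; _/_; _%_; _⊓_; ∣_-_∣; _≤_; _<_; _≤?_;
         z≤n; s≤s; s≤s⁻¹; z<s; >-nonZero)
open import Data.Nat.DivMod using (m<n⇒m%n≡m; n%n≡0; m≡m%n+[m/n]*n; m%n<n; m/n*n≤m; m<n*o⇒m/o<n)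
open import Data.Nat.Properties
open import Data.Nat.Tactic.RingSolver using (solve-∀)
open import Data.Product using (_×_; _,_; proj₁; proj₂; ∃; ∃-syntax)
open import Data.Product.Properties using (≡-dec)
open import Data.Sum using (_⊎_; inj₁; inj₂; [_,_])
open import Function.Base using (_∘_)
open import Function.Bundles using (_↣_; Injection)
open import Function.Properties.Inverse using (↔⇒↣)
open import Relation.Binary.Definitions using (Symmetric; DecidableEquality)
open import Relation.Binary.PropositionalEquality
  using (_≡_; _≢_; refl; sym; trans; cong; cong₂; subst; module ≡-Reasoning)
open import Relation.Nullary using (¬_; Dec; yes; no; contradiction)
open import Relation.Nullary.Decidable using (map′; ¬?; _×-dec_; _⊎-dec_)
open import Relation.Unary using (Decidable)

Searchable : Set → Set₁
Searchable A = ∀ {P : A → Set} → Decidable P → Dec (∃ P)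

×-searchable : ∀ {A B} → Searchable A → Searchable B → Searchable (A × B)
×-searchable search-A search-B P? =
  map′ (λ (a , b , p) → (a , b) , p) (λ ((a , b) , p) → a , b , p)
       (search-A λ a → search-B λ b → P? (a , b))

Least : (ℕ → Set) → ℕ → Set
Least P m = P m × (∀ l → l < m → ¬ P l)

least-below? : ∀ {P : ℕ → Set} → Decidable P → ∀ n → (∀ l → l < n → ¬ P l) ⊎ (∃[ m ] m < n × Least P m)
least-below? P? zero = inj₁ λ _ ()
least-below? P? (suc n) with least-below? P? n
... | inj₂ (m , m<n , least) = inj₂ (m , m<n⇒m<1+n m<n , least)
... | inj₁ below-n with P? n
...   | yes pn = inj₂ (n , n<1+n n , pn , below-n)
...   | no ¬pn = inj₁ λ l l<1+n → [ below-n l , (λ { refl → ¬pn }) ] (m<1+n⇒m<n∨m≡n l<1+n)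

least-witness : ∀ {P : ℕ → Set} → Decidable P → ∀ {n} → P n → ∃[ m ] m ≤ n × Least P m
least-witness P? {n} pn with least-below? P? (suc n)
... | inj₁ below = contradiction pn (below n (n<1+n n))
... | inj₂ (m , m<1+n , least) = m , s≤s⁻¹ m<1+n , least

walk-++ : ∀ {G u v w p q} → Walk G u v p → Walk G v w q → Walk G u w (p + q)
walk-++ here       w₂ = w₂
walk-++ (step a w₁) w₂ = step a (walk-++ w₁ w₂)

walk-snoc : ∀ {G u v w p} → Walk G u v p → Adj G v w → Walk G u w (suc p)
walk-snoc {p = p} w a = subst (Walk _ _ _) (+-comm p 1) (walk-++ w (step a here))

walk-reverse : ∀ {G} → Symmetric (Adj G) → ∀ {u v p} → Walk G u v p → Walk G v u p
walk-reverse sym-adj here       = here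
walk-reverse sym-adj (step a w) = walk-snoc (walk-reverse sym-adj w) (sym-adj a)

walk? : ∀ {G} → Searchable (V G) → DecidableEquality (V G) → (∀ u v → Dec (Adj G u v)) →
        ∀ l u v → Dec (Walk G u v l)
walk? search _≟_ adj? zero u v with u ≟ v
... | yes refl = yes here
... | no u≢v   = no λ { here → u≢v refl }
walk? search _≟_ adj? (suc l) u v =
  map′ (λ (w , a , p) → step a p) (λ { (step a p) → _ , a , p })
       (search λ w → adj? u w ×-dec walk? search _≟_ adj? l w v)

walk⇒dist : ∀ {G u v L} → (∀ l → Dec (Walk G u v l)) → Walk G u v L → ∃[ m ] m ≤ L × IsDist G u v m
walk⇒dist walk-dec w = least-witness walk-dec w

dist≤walk : ∀ {G u v m L} → IsDist G u v m → Walk G u v L → m ≤ L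
dist≤walk (_ , shortest) w = ≮⇒≥ λ L<m → shortest _ L<m w

Lipschitz : (G : Graph) → (V G → ℕ) → Set
Lipschitz G φ = ∀ {u v} → Adj G u v → φ v ≤ suc (φ u)

lipschitz-walk : ∀ {G φ} → Lipschitz G φ → ∀ {u v l} → Walk G u v l → φ v ≤ φ u + l
lipschitz-walk lip {u} here = ≤-reflexive (sym (+-identityʳ _))
lipschitz-walk {φ = φ} lip {u} {v} {suc l} (step {w = w} a rest) = begin
  φ v           ≤⟨ lipschitz-walk lip rest ⟩
  φ w + l       ≤⟨ +-monoˡ-≤ l (lip a) ⟩
  suc (φ u) + l ≡⟨ +-suc (φ u) l ⟨
  φ u + suc l   ∎
  where open ≤-Reasoning

record TriangleWithin (G : Graph) (B : ℕ) (x y z : V G) : Set where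
  constructor triangle
  field
    {p q r} : ℕ
    x→y     : Walk G x y p
    y→z     : Walk G y z q
    z→x     : Walk G z x r
    bounded : p + q + r ≤ B

triangle-rotate : ∀ {G B x y z} → TriangleWithin G B x y z → TriangleWithin G B y z x
triangle-rotate {B = B} (triangle {p} {q} {r} x→y y→z z→x bounded) =
  triangle y→z z→x x→y (subst (_≤ B) (rotate p q r) bounded)
  where
  rotate : ∀ p q r → p + q + r ≡ q + r + p
  rotate = solve-∀

triangle-flip : ∀ {G B x y z} → Symmetric (Adj G) → TriangleWithin G B x z y → TriangleWithin G B x y z
triangle-flip {B = B} sym-adj (triangle {p} {q} {r} x→z z→y y→x bounded) =
  triangle (walk-reverse sym-adj y→x) (walk-reverse sym-adj z→y) (walk-reverse sym-adj x→z)
           (subst (_≤ B) (flip p q r) bounded)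
  where
  flip : ∀ p q r → p + q + r ≡ r + q + p
  flip = solve-∀

wlog-sorted₃ : ∀ {A : Set} (key : A → ℕ) (P : A → A → A → Set) →
               (∀ {x y z} → P x y z → P y z x) → (∀ {x y z} → P x z y → P x y z) →
               (∀ x y z → key x ≤ key y → key y ≤ key z → P x y z) → ∀ x y z → P x y z
wlog-sorted₃ key P rotate flip sorted x y z
  with ≤-total (key x) (key y) | ≤-total (key y) (key z) | ≤-total (key x) (key z)
... | inj₁ xy | inj₁ yz | _       = sorted x y z xy yz
... | inj₁ xy | inj₂ zy | inj₁ xz = flip (sorted x z y xz zy)
... | inj₁ xy | inj₂ zy | inj₂ zx = rotate (sorted z x y zx xy)
... | inj₂ yx | inj₁ yz | inj₁ xz = flip (rotate (sorted y x z yx xz))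
... | inj₂ yx | inj₁ yz | inj₂ zx = rotate (rotate (sorted y z x yz zx))
... | inj₂ yx | inj₂ zy | _       = flip (rotate (rotate (sorted z y x zy yx)))

□-adj? : ∀ {G H} → DecidableEquality (V G) → DecidableEquality (V H) →
         (∀ g g′ → Dec (Adj G g g′)) → (∀ h h′ → Dec (Adj H h h′)) →
         ∀ u v → Dec (Adj (G □ H) u v)
□-adj? _≟G_ _≟H_ adj-G? adj-H? (g , h) (g′ , h′) =
  ((g ≟G g′) ×-dec adj-H? h h′) ⊎-dec ((h ≟H h′) ×-dec adj-G? g g′)

□-walkˡ : ∀ {G H a b p} {h : V H} → Walk G a b p → Walk (G □ H) (a , h) (b , h) p
□-walkˡ here       = here
□-walkˡ (step a w) = step (inj₂ (refl , a)) (□-walkˡ w)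

□-walkʳ : ∀ {G H a b p} {g : V G} → Walk H a b p → Walk (G □ H) (g , a) (g , b) p
□-walkʳ here       = here
□-walkʳ (step a w) = step (inj₁ (refl , a)) (□-walkʳ w)

□-walk : ∀ {G H g g′ h h′ p q} → Walk G g g′ p → Walk H h h′ q → Walk (G □ H) (g , h) (g′ , h′) (p + q)
□-walk w₁ w₂ = walk-++ (□-walkˡ w₁) (□-walkʳ w₂)

□-triangle : ∀ {G H B B′ x y z x′ y′ z′} → TriangleWithin G B x y z → TriangleWithin H B′ x′ y′ z′ →
             TriangleWithin (G □ H) (B + B′) (x , x′) (y , y′) (z , z′)
□-triangle {B = B} {B′} (triangle {p} {q} {r} xy yz zx bounded)
                        (triangle {p′} {q′} {r′} xy′ yz′ zx′ bounded′) =
  triangle (□-walk xy xy′) (□-walk yz yz′) (□-walk zx zx′)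
           (subst (_≤ B + B′) (interleave p p′ q q′ r r′) (+-mono-≤ bounded bounded′))
  where
  interleave : ∀ p p′ q q′ r r′ → p + q + r + (p′ + q′ + r′) ≡ p + p′ + (q + q′) + (r + r′)
  interleave = solve-∀

□-lipschitz : ∀ {G H φ ψ} → Lipschitz G φ → Lipschitz H ψ →
              Lipschitz (G □ H) (λ u → φ (proj₁ u) + ψ (proj₂ u))
□-lipschitz {φ = φ} {ψ} lip-G lip-H {g , h} (inj₁ (refl , a)) =
  ≤-trans (+-monoʳ-≤ (φ g) (lip-H a)) (≤-reflexive (+-suc (φ g) (ψ h)))
□-lipschitz {ψ = ψ} lip-G lip-H {g , h} (inj₂ (refl , a)) = +-monoˡ-≤ (ψ h) (lip-G a)

radio-gap : ∀ {G c D B x y z} → (∀ l u v → Dec (Walk G u v l)) → IsRadioLabeling G c → IsDiam G D →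
            TriangleWithin G B x y z → x ≢ y → y ≢ z → z ≢ x → c x ≤ c y → c y ≤ c z →
            3 * suc D ≤ B + 2 * (c z ∸ c x)
radio-gap {G} {c} {D} {B} {x} {y} {z} walk-dec (_ , radio) diam (triangle x→y y→z z→x bounded)
          x≢y y≢z z≢x cx≤cy cy≤cz
  with walk⇒dist (λ l → walk-dec l x y) x→y | walk⇒dist (λ l → walk-dec l y z) y→z
     | walk⇒dist (λ l → walk-dec l z x) z→x | m≤n⇒∃[o]m+o≡n cx≤cy | m≤n⇒∃[o]m+o≡n cy≤cz
... | m₁ , m₁≤p , d₁ | m₂ , m₂≤q , d₂ | m₃ , m₃≤r , d₃ | s , cx+s≡cy | t , cy+t≡cz = begin
  3 * suc D                            ≡⟨ triple (suc D) ⟩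
  suc D + suc D + suc D                ≤⟨ +-mono-≤ (+-mono-≤ xy-gap yz-gap) zx-gap ⟩
  (m₁ + s) + (m₂ + t) + (m₃ + (s + t)) ≡⟨ regroup m₁ m₂ m₃ s t ⟩
  m₁ + m₂ + m₃ + 2 * (s + t)           ≤⟨ +-monoˡ-≤ _ (≤-trans (+-mono-≤ (+-mono-≤ m₁≤p m₂≤q) m₃≤r) bounded) ⟩
  B + 2 * (s + t)                      ≡⟨ cong (λ g → B + 2 * g) cz∸cx≡s+t ⟨
  B + 2 * (c z ∸ c x)                  ∎
  where
  open ≤-Reasoning
  triple : ∀ d → 3 * d ≡ d + d + d
  triple = solve-∀
  regroup : ∀ m₁ m₂ m₃ s t → (m₁ + s) + (m₂ + t) + (m₃ + (s + t)) ≡ m₁ + m₂ + m₃ + 2 * (s + t)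
  regroup = solve-∀
  cx+[s+t]≡cz : c x + (s + t) ≡ c z
  cx+[s+t]≡cz = trans (sym (+-assoc (c x) s t)) (trans (cong (_+ t) cx+s≡cy) cy+t≡cz)
  cz∸cx≡s+t : c z ∸ c x ≡ s + t
  cz∸cx≡s+t = trans (cong (_∸ c x) (sym cx+[s+t]≡cz)) (m+n∸m≡n (c x) (s + t))
  gap : ∀ {u v m g} → u ≢ v → IsDist G u v m → ∣ c u - c v ∣ ≡ g → suc D ≤ m + g
  gap u≢v d eq = subst (λ g → suc D ≤ _ + g) eq (radio _ _ u≢v _ D d diam)
  ∣a-[a+s]∣≡s : ∀ {a b} s → a + s ≡ b → ∣ a - b ∣ ≡ s
  ∣a-[a+s]∣≡s {a} s refl = ∣m-m+n∣≡n a s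
  xy-gap : suc D ≤ m₁ + s
  xy-gap = gap x≢y d₁ (∣a-[a+s]∣≡s s cx+s≡cy)
  yz-gap : suc D ≤ m₂ + t
  yz-gap = gap y≢z d₂ (∣a-[a+s]∣≡s t cy+t≡cz)
  zx-gap : suc D ≤ m₃ + (s + t)
  zx-gap = gap z≢x d₃ (trans (∣-∣-comm (c z) (c x)) (∣a-[a+s]∣≡s {c x} (s + t) cx+[s+t]≡cz))

module _ {N : ℕ} where

  cycle-sym : Symmetric (Adj (cycle (suc N)))
  cycle-sym (i≢j , inj₁ e) = (λ j≡i → i≢j (sym j≡i)) , inj₂ e
  cycle-sym (i≢j , inj₂ e) = (λ j≡i → i≢j (sym j≡i)) , inj₁ e

  cycle-adj? : ∀ i j → Dec (Adj (cycle (suc N)) i j)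
  cycle-adj? i j = ¬? (i ≟ᶠ j) ×-dec ((toℕ j ≟ (toℕ i + 1) % suc N) ⊎-dec (toℕ i ≟ (toℕ j + 1) % suc N))

  step-adj : ∀ {i j : Fin (suc N)} → toℕ i + 1 ≡ toℕ j → Adj (cycle (suc N)) i j
  step-adj {i} {j} i+1≡j =
    (λ { refl → <⇒≢ (m<m+n (toℕ i) z<s) (sym i+1≡j) }) ,
    inj₁ (trans (sym i+1≡j) (sym (m<n⇒m%n≡m (subst (_< suc N) (sym i+1≡j) (toℕ<n j)))))

  wrap-adj : 0 < N → Adj (cycle (suc N)) (fromℕ N) zero
  wrap-adj 0<N =
    (λ N≡0 → <⇒≢ 0<N (sym (trans (sym (toℕ-fromℕ N)) (cong toℕ N≡0)))) ,
    inj₁ (sym (begin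
      (toℕ (fromℕ N) + 1) % suc N ≡⟨ cong (λ m → (m + 1) % suc N) (toℕ-fromℕ N) ⟩
      (N + 1) % suc N             ≡⟨ cong (_% suc N) (+-comm N 1) ⟩
      suc N % suc N               ≡⟨ n%n≡0 (suc N) ⟩
      0                           ∎))
    where open ≡-Reasoning

  walk-up : ∀ d {i j : Fin (suc N)} → toℕ i + d ≡ toℕ j → Walk (cycle (suc N)) i j d
  walk-up zero {i} i+0≡j =
    subst (λ j → Walk _ i j 0) (toℕ-injective (trans (sym (+-identityʳ (toℕ i))) i+0≡j)) here
  walk-up (suc d) {i} {j} i+d≡j =
    step (step-adj (sym (toℕ-fromℕ< i+1<n)))
         (walk-up d (trans (cong (_+ d) (toℕ-fromℕ< i+1<n)) (trans (+-assoc (toℕ i) 1 d) i+d≡j)))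
    where
    i+1<n : toℕ i + 1 < suc N
    i+1<n = ≤-<-trans (+-monoʳ-≤ (toℕ i) (s≤s z≤n)) (subst (_< suc N) (sym i+d≡j) (toℕ<n j))

  walk-around : 0 < N → ∀ e {i j : Fin (suc N)} → toℕ i + e ≡ N → Walk (cycle (suc N)) i j (e + suc (toℕ j))
  walk-around 0<N e {j = j} i+e≡N =
    walk-++ (walk-up e (trans i+e≡N (sym (toℕ-fromℕ N)))) (step (wrap-adj 0<N) (walk-up (toℕ j) refl))

cycle-triangle : ∀ {N} (x y z : Fin (suc N)) → TriangleWithin (cycle (suc N)) (suc N) x y z
cycle-triangle {zero} zero zero zero = triangle here here here z≤n
cycle-triangle {suc N} =
  wlog-sorted₃ toℕ (TriangleWithin _ _) triangle-rotate (triangle-flip cycle-sym) sorted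
  where
  sorted : ∀ x y z → toℕ x ≤ toℕ y → toℕ y ≤ toℕ z → TriangleWithin (cycle (suc (suc N))) (suc (suc N)) x y z
  sorted x y z x≤y y≤z with m≤n⇒∃[o]m+o≡n x≤y | m≤n⇒∃[o]m+o≡n y≤z | m≤n⇒∃[o]m+o≡n (s≤s⁻¹ (toℕ<n z))
  ... | d₁ , x+d₁≡y | d₂ , y+d₂≡z | e , z+e≡N =
    triangle (walk-up d₁ x+d₁≡y) (walk-up d₂ y+d₂≡z) (walk-around z<s e z+e≡N) (≤-reflexive once-around)
    where
    open ≡-Reasoning
    regroup : ∀ a d₁ d₂ e → d₁ + d₂ + (e + suc a) ≡ suc (a + d₁ + d₂ + e)
    regroup = solve-∀
    once-around : d₁ + d₂ + (e + suc (toℕ x)) ≡ suc (suc N)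
    once-around = begin
      d₁ + d₂ + (e + suc (toℕ x)) ≡⟨ regroup (toℕ x) d₁ d₂ e ⟩
      suc (toℕ x + d₁ + d₂ + e)   ≡⟨ cong (λ m → suc (m + d₂ + e)) x+d₁≡y ⟩
      suc (toℕ y + d₂ + e)        ≡⟨ cong (λ m → suc (m + e)) y+d₂≡z ⟩
      suc (toℕ z + e)             ≡⟨ cong suc z+e≡N ⟩
      suc (suc N)                 ∎

dist-to-0 : ∀ {N} → Fin (suc N) → ℕ
dist-to-0 {N} i = toℕ i ⊓ (suc N ∸ toℕ i)

-- The right-hand side unfolds to suc x ⊓ suc (n ∸ x), which is what ⊓-glb produces.
⊓-complement-step : ∀ n x y → x ≤ suc y → y ≤ suc x → y ⊓ (n ∸ y) ≤ suc (x ⊓ (n ∸ x))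
⊓-complement-step n x y x≤1+y y≤1+x =
  ⊓-glb (≤-trans (m⊓n≤m y _) y≤1+x) (≤-trans (m⊓n≤n y _) (≤-trans (∸-monoʳ-≤ (suc n) x≤1+y) 1+n∸x≤1+[n∸x]))
  where
  1+n∸x≤1+[n∸x] : suc n ∸ x ≤ suc (n ∸ x)
  1+n∸x≤1+[n∸x] = m≤n+o⇒m∸n≤o (suc n) x (subst (suc n ≤_) (sym (+-suc x (n ∸ x))) (s≤s (m≤n+m∸n n x)))

dist-to-0-step : ∀ {N} {i j : Fin (suc N)} → toℕ j ≡ (toℕ i + 1) % suc N →
                 dist-to-0 j ≤ suc (dist-to-0 i) × dist-to-0 i ≤ suc (dist-to-0 j)
dist-to-0-step {N} {i} {j} e with m≤n⇒m<n∨m≡n (subst (_≤ suc N) (+-comm 1 (toℕ i)) (toℕ<n i))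
... | inj₁ i+1<n =
  ⊓-complement-step (suc N) (toℕ i) (toℕ j) i≤1+j j≤1+i , ⊓-complement-step (suc N) (toℕ j) (toℕ i) j≤1+i i≤1+j
  where
  j≡i+1 : toℕ j ≡ toℕ i + 1
  j≡i+1 = trans e (m<n⇒m%n≡m i+1<n)
  j≤1+i : toℕ j ≤ suc (toℕ i)
  j≤1+i = ≤-reflexive (trans j≡i+1 (+-comm (toℕ i) 1))
  i≤1+j : toℕ i ≤ suc (toℕ j)
  i≤1+j = ≤-trans (n≤1+n (toℕ i)) (s≤s (≤-trans (m≤m+n (toℕ i) 1) (≤-reflexive (sym j≡i+1))))
... | inj₂ i+1≡n = subst (λ m → m ⊓ (suc N ∸ m) ≤ suc (dist-to-0 i)) (sym j≡0) z≤n ,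
                   subst (λ m → dist-to-0 i ≤ suc (m ⊓ (suc N ∸ m))) (sym j≡0) i-next-to-0
  where
  j≡0 : toℕ j ≡ 0
  j≡0 = trans e (trans (cong (_% suc N) i+1≡n) (n%n≡0 (suc N)))
  i-next-to-0 : dist-to-0 i ≤ 1
  i-next-to-0 =
    ≤-trans (m⊓n≤n (toℕ i) _) (≤-reflexive (trans (cong (_∸ toℕ i) (sym i+1≡n)) (m+n∸m≡n (toℕ i) 1)))

dist-to-0-lipschitz : ∀ {N} → Lipschitz (cycle (suc N)) dist-to-0
dist-to-0-lipschitz (_ , inj₁ e) = proj₁ (dist-to-0-step e)
dist-to-0-lipschitz (_ , inj₂ e) = proj₂ (dist-to-0-step e)

around-short : ∀ {k a d b e} → a + d ≡ b → b + e ≡ 2 * k → k < d → e + suc a ≤ k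
around-short {k} {a} {d} {b} {e} a+d≡b b+e≡2k k<d = +-cancelˡ-≤ (suc k) _ _ (begin
  suc k + (e + suc a) ≤⟨ +-monoˡ-≤ (e + suc a) k<d ⟩
  d + (e + suc a)     ≡⟨ regroup a d e ⟩
  suc (a + d + e)     ≡⟨ cong (λ m → suc (m + e)) a+d≡b ⟩
  suc (b + e)         ≡⟨ cong suc b+e≡2k ⟩
  suc (2 * k)         ≡⟨ split k ⟩
  suc k + k           ∎)
  where
  open ≤-Reasoning
  regroup : ∀ a d e → d + (e + suc a) ≡ suc (a + d + e)
  regroup = solve-∀
  split : ∀ k → suc (2 * k) ≡ suc k + k
  split = solve-∀

odd-cycle-near-sorted : ∀ k {i j : Fin (suc (2 * k))} → toℕ i ≤ toℕ j →
                        ∃[ p ] p ≤ k × Walk (cycle (suc (2 * k))) i j p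
odd-cycle-near-sorted k {i} {j} i≤j with m≤n⇒∃[o]m+o≡n i≤j
... | d , i+d≡j with d ≤? k
...   | yes d≤k = d , d≤k , walk-up d i+d≡j
...   | no d≰k with m≤n⇒∃[o]m+o≡n (s≤s⁻¹ (toℕ<n j))
...     | e , j+e≡2k =
  _ , around-short i+d≡j j+e≡2k (≰⇒> d≰k) , walk-reverse cycle-sym (walk-around 0<2k e j+e≡2k)
  where
  0<2k : 0 < 2 * k
  0<2k = <-≤-trans (≤-<-trans z≤n (≰⇒> d≰k))
                   (≤-trans (m≤n+m d (toℕ i)) (≤-trans (≤-reflexive i+d≡j) (s≤s⁻¹ (toℕ<n j))))

odd-cycle-near : ∀ k (i j : Fin (suc (2 * k))) → ∃[ p ] p ≤ k × Walk (cycle (suc (2 * k))) i j p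
odd-cycle-near k i j with ≤-total (toℕ i) (toℕ j)
... | inj₁ i≤j = odd-cycle-near-sorted k i≤j
... | inj₂ j≤i with odd-cycle-near-sorted k j≤i
...   | p , p≤k , j→i = p , p≤k , walk-reverse cycle-sym j→i

ThreeSpread : ∀ {A : Set} → ℕ → (A → ℕ) → Set
ThreeSpread {A} b c = ∀ {x y z : A} → x ≢ y → y ≢ z → z ≢ x → c x ≤ c y → c y ≤ c z → b + c x < c z

module Torus (k : ℕ) where

  n : ℕ
  n = suc (2 * k)

  T : Graph
  T = cycle n □ cycle n

  k+k≡2k : k + k ≡ 2 * k
  k+k≡2k = cong (k +_) (sym (+-identityʳ k))

  torus-searchable : Searchable (V T)
  torus-searchable = ×-searchable any? any?

  torus-walk? : ∀ l u v → Dec (Walk T u v l)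
  torus-walk? = walk? torus-searchable (≡-dec _≟ᶠ_ _≟ᶠ_)
                      (□-adj? _≟ᶠ_ _≟ᶠ_ cycle-adj? cycle-adj?)

  torus-triangle : ∀ x y z → TriangleWithin T (n + n) x y z
  torus-triangle (x , x′) (y , y′) (z , z′) = □-triangle (cycle-triangle x y z) (cycle-triangle x′ y′ z′)

  torus-diam : IsDiam T (2 * k)
  torus-diam = ((zero , zero) , (mid , mid) , far , no-shorter) , within
    where
    k<n : k < n
    k<n = s≤s (m≤m+n k (k + 0))
    mid : Fin n
    mid = fromℕ< k<n
    0→mid : Walk (cycle n) zero mid k
    0→mid = walk-up k (sym (toℕ-fromℕ< k<n))
    far : Walk T (zero , zero) (mid , mid) (2 * k)
    far = subst (Walk T _ _) k+k≡2k (□-walk 0→mid 0→mid)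
    dist-to-0-mid : dist-to-0 mid ≡ k
    dist-to-0-mid = trans (cong (λ m → m ⊓ (n ∸ m)) (toℕ-fromℕ< k<n))
                          (m≤n⇒m⊓n≡m (m+n≤o⇒m≤o∸n k (≤-trans (≤-reflexive k+k≡2k) (n≤1+n (2 * k)))))
    lipschitz : Lipschitz T (λ u → dist-to-0 (proj₁ u) + dist-to-0 (proj₂ u))
    lipschitz = □-lipschitz {G = cycle n} {H = cycle n} dist-to-0-lipschitz dist-to-0-lipschitz
    no-shorter : ∀ l → l < 2 * k → ¬ Walk T (zero , zero) (mid , mid) l
    no-shorter l l<2k w = <⇒≱ l<2k (begin
      2 * k                           ≡⟨ k+k≡2k ⟨
      k + k                           ≡⟨ cong₂ _+_ dist-to-0-mid dist-to-0-mid ⟨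
      dist-to-0 mid + dist-to-0 mid   ≤⟨ lipschitz-walk lipschitz w ⟩
      l                               ∎)
      where open ≤-Reasoning
    within : ∀ u v m → IsDist T u v m → m ≤ 2 * k
    within (g , h) (g′ , h′) m d with odd-cycle-near k g g′ | odd-cycle-near k h h′
    ... | p , p≤k , g→g′ | q , q≤k , h→h′ =
      ≤-trans (dist≤walk d (□-walk g→g′ h→h′)) (≤-trans (+-mono-≤ p≤k q≤k) (≤-reflexive k+k≡2k))

  radio⇒three-spread : ∀ {c} → IsRadioLabeling T c → ThreeSpread k c
  radio⇒three-spread {c} R {x} {y} {z} x≢y y≢z z≢x cx≤cy cy≤cz = begin-strict
    k + c x             <⟨ +-monoˡ-< (c x) k<gap ⟩
    (c z ∸ c x) + c x   ≡⟨ m∸n+n≡m (≤-trans cx≤cy cy≤cz) ⟩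
    c z                 ∎
    where
    open ≤-Reasoning
    triple : ∀ n → 3 * n ≡ n + n + n
    triple = solve-∀
    n≤2*gap : n ≤ 2 * (c z ∸ c x)
    n≤2*gap = +-cancelˡ-≤ (n + n) _ _ (subst (_≤ n + n + 2 * (c z ∸ c x)) (triple n)
                (radio-gap torus-walk? R torus-diam (torus-triangle x y z) x≢y y≢z z≢x cx≤cy cy≤cz))
    k<gap : k < c z ∸ c x
    k<gap = *-cancelˡ-< 2 k (c z ∸ c x) n≤2*gap

record Collision₃ {N m} (f : Fin N → Fin m) : Set where
  constructor collision
  field
    {i j l} : Fin N
    i≢j     : i ≢ j
    j≢l     : j ≢ l
    l≢i     : l ≢ i
    fi≡fj   : f i ≡ f j
    fj≡fl   : f j ≡ f l

-- If no third point joins the pair found by the ordinary pigeonhole principle, delete the pair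
-- and its value and recurse.
pigeonhole₃ : ∀ {m N} → m + m < N → (f : Fin N → Fin m) → Collision₃ f
pigeonhole₃ {zero}  {suc N}       _ f = contradiction (f zero) λ ()
pigeonhole₃ {suc m} {suc zero}    (s≤s ()) f
pigeonhole₃ {suc m} {suc (suc N)} 2m+2<N f
  with pigeonhole (≤-trans (s≤s (m≤m+n (suc m) (suc m))) 2m+2<N) f
... | i , j , i<j , fi≡fj with any? (λ l → ¬? (j ≟ᶠ l) ×-dec ¬? (l ≟ᶠ i) ×-dec (f j ≟ᶠ f l))
...   | yes (l , j≢l , l≢i , fj≡fl) = collision (<⇒≢ᶠ i<j) j≢l l≢i fi≡fj fj≡fl
...   | no no-third = lift (pigeonhole₃ m+m<N g)
  where
  i≢j : i ≢ j
  i≢j = <⇒≢ᶠ i<j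
  m+m<N : m + m < N
  m+m<N = s≤s⁻¹ (s≤s⁻¹ (subst (_< suc (suc N)) (cong suc (+-suc m m)) 2m+2<N))
  skip : Fin N → Fin (suc (suc N))
  skip x = punchIn i (punchIn (punchOut i≢j) x)
  skip-injective : ∀ {x y} → skip x ≡ skip y → x ≡ y
  skip-injective = punchIn-injective _ _ _ ∘ punchIn-injective i _ _
  j≢skip : ∀ x → j ≢ skip x
  j≢skip x j≡skip = punchInᵢ≢i (punchOut i≢j) x
    (sym (punchIn-injective i _ _ (trans (punchIn-punchOut i≢j) j≡skip)))
  fj≢f-skip : ∀ x → f j ≢ f (skip x)
  fj≢f-skip x fj≡f-skip = no-third (skip x , j≢skip x , punchInᵢ≢i i _ , fj≡f-skip)
  g : Fin N → Fin m
  g x = punchOut (fj≢f-skip x)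
  g-collision⇒f-collision : ∀ {x y} → g x ≡ g y → f (skip x) ≡ f (skip y)
  g-collision⇒f-collision = punchOut-injective (fj≢f-skip _) (fj≢f-skip _)
  lift : Collision₃ g → Collision₃ f
  lift (collision x≢y y≢w w≢x gx≡gy gy≡gw) =
    collision (x≢y ∘ skip-injective) (y≢w ∘ skip-injective) (w≢x ∘ skip-injective)
              (g-collision⇒f-collision gx≡gy) (g-collision⇒f-collision gy≡gw)

same-quotient⇒close : ∀ b {a a′} → a / suc b ≡ a′ / suc b → a′ < suc b + a
same-quotient⇒close b {a} {a′} eq = begin-strict
  a′                              ≡⟨ m≡m%n+[m/n]*n a′ (suc b) ⟩
  a′ % suc b + a′ / suc b * suc b ≡⟨ cong (λ q → a′ % suc b + q * suc b) eq ⟨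
  a′ % suc b + a / suc b * suc b  <⟨ +-monoˡ-< _ (m%n<n a′ (suc b)) ⟩
  suc b + a / suc b * suc b       ≤⟨ +-monoʳ-≤ (suc b) (m/n*n≤m a (suc b)) ⟩
  suc b + a                       ∎
  where open ≤-Reasoning

-- Blocks of width suc b, shifted so that the labels 1, 2, …, suc b form block 0.
block : ∀ b → ℕ → ℕ
block b a = pred a / suc b

same-block⇒close : ∀ b a a′ → 0 < a → block b a ≡ block b a′ → a′ ≤ b + a
same-block⇒close b (suc a) zero     _ _  = z≤n
same-block⇒close b (suc a) (suc a′) _ eq =
  ≤-trans (same-quotient⇒close b eq) (≤-reflexive (sym (+-suc b a)))

three-spread⇒no-full-block : ∀ {A : Set} {b} (c : A → ℕ) → (∀ u → 0 < c u) → ThreeSpread b c →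
                             ∀ x y z → x ≢ y → y ≢ z → z ≢ x →
                             block b (c x) ≡ block b (c y) → block b (c y) ≡ block b (c z) → ⊥
three-spread⇒no-full-block {b = b} c positive spread =
  wlog-sorted₃ c NoFullBlock rotate flip sorted
  where
  NoFullBlock : _ → _ → _ → Set
  NoFullBlock x y z = x ≢ y → y ≢ z → z ≢ x →
                      block b (c x) ≡ block b (c y) → block b (c y) ≡ block b (c z) → ⊥
  rotate : ∀ {x y z} → NoFullBlock x y z → NoFullBlock y z x
  rotate none y≢z z≢x x≢y y~z z~x = none x≢y y≢z z≢x (sym (trans y~z z~x)) y~z
  flip : ∀ {x y z} → NoFullBlock x z y → NoFullBlock x y z
  flip none x≢y y≢z z≢x x~y y~z = none (z≢x ∘ sym) (y≢z ∘ sym) (x≢y ∘ sym) (trans x~y y~z) (sym y~z)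
  sorted : ∀ x y z → c x ≤ c y → c y ≤ c z → NoFullBlock x y z
  sorted x y z cx≤cy cy≤cz x≢y y≢z z≢x x~y y~z =
    <⇒≱ (spread x≢y y≢z z≢x cx≤cy cy≤cz) (same-block⇒close b (c x) (c z) (positive x) (trans x~y y~z))

three-spread⇒spanAtLeast : ∀ {G N M b} (c : V G → ℕ) → Searchable (V G) → Fin N ↣ V G →
                           (∀ u → 0 < c u) → ThreeSpread b c → M + M < N → SpanAtLeast G c (M * suc b + 1)
three-spread⇒spanAtLeast {G} {N} {M} {b} c search ι positive spread M+M<N
  with search (λ u → M * suc b + 1 ≤? c u)
... | yes large = large
... | no all-small =
  ⊥-elim (three-spread⇒no-full-block c positive spread (to i) (to j) (to l)
            (i≢j ∘ injective) (j≢l ∘ injective) (l≢i ∘ injective) (same-block fi≡fj) (same-block fj≡fl))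
  where
  open Injection ι using (to; injective)
  block<M : ∀ u → block b (c u) < M
  block<M u = m<n*o⇒m/o<n (<-≤-trans (≤-reflexive (suc-pred (c u) {{>-nonZero (positive u)}}))
                (s≤s⁻¹ (subst (c u <_) (+-comm (M * suc b) 1) (≰⇒> λ large → all-small (u , large)))))
  f : Fin N → Fin M
  f i = fromℕ< (block<M (to i))
  same-block : ∀ {i j} → f i ≡ f j → block b (c (to i)) ≡ block b (c (to j))
  same-block fi≡fj = trans (sym (toℕ-fromℕ< _)) (trans (cong toℕ fi≡fj) (toℕ-fromℕ< _))
  open Collision₃ (pigeonhole₃ M+M<N f)

[m/2]+[m/2]≤m : ∀ m → m / 2 + m / 2 ≤ m
[m/2]+[m/2]≤m m = ≤-trans (≤-reflexive (double (m / 2))) (m/n*n≤m m 2)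
  where
  double : ∀ h → h + h ≡ h * 2
  double = solve-∀

theorem2p6 : (k : ℕ) → let n = suc (2 * k) in
    RnAtLeast (cycle n □ cycle n) ((((n * n) ∸ 1) / 2) * (k + 1) + 1)
-- n * n reduces to a successor, so n * n ∸ 1 is its predecessor and M + M < n * n is s≤s of a bound.
theorem2p6 k c radio =
  subst (λ s → SpanAtLeast T c (M * s + 1)) (+-comm 1 k)
    (three-spread⇒spanAtLeast {G = T} {M = M} c torus-searchable (↔⇒↣ *↔×)
       (proj₁ radio) (radio⇒three-spread radio) (s≤s ([m/2]+[m/2]≤m (n * n ∸ 1))))
  where
  open Torus k
  M : ℕ
  M = (n * n ∸ 1) / 2
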